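{- For every $n\in\mathbb{N}$, \[ \sum_{k=1}^{n}\frac{(-1)^kH_{n-k}}{k\binom{n}{k}}=\frac{1-(-1)^n}{(n+1)^2}-\frac{H_n}{n+1}. \]
   Context: $H_j=\sum_{i=1}^j\frac1i$ for $j\in\mathbb{N}_0$, with $H_0=0$. -}

module Defs where

open import Data.Nat as ℕ using (ℕ; zero; suc; _∸_; _≤_; z≤n; s≤s; NonZero)
open import Data.Nat.Combinatorics using (_C_; nCk+nC[k+1]≡[n+1]C[k+1])
open import Data.Integer using (ℤ; +_)
open import Data.Rational using (ℚ; _/_; _+_; _*_; -_; 0ℚ; 1ℚ)
open import Relation.Binary.PropositionalEquality using (subst)
open import Relation.Nullary using (yes; no)
open import Data.Nat.Properties using (_≤?_; m*n≢0)

H : ℕ → ℚ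
H zero    = 0ℚ
H (suc j) = H j + (+ 1) / suc j

sgn : ℕ → ℚ
sgn zero    = 1ℚ
sgn (suc k) = - sgn k

Σ₁ : ℕ → (ℕ → ℚ) → ℚ
Σ₁ zero    f = 0ℚ
Σ₁ (suc n) f = Σ₁ n f + f (suc n)

nCk-nonZero : ∀ n k → k ≤ n → NonZero (n C k)
nCk-nonZero n       zero    _       = _
nCk-nonZero (suc n) (suc k) (s≤s k≤n) =
  subst NonZero (nCk+nC[k+1]≡[n+1]C[k+1] n k) (go (n C k) (n C suc k) (nCk-nonZero n k k≤n))
  where
  go : ∀ a b → NonZero a → NonZero (a ℕ.+ b)
  go (suc a) b _ = _

-- the summand (-1)^k H_{n-k} / (k · C(n,k)), for 1 ≤ k ≤ n; 0 outside that range
term : ℕ → ℕ → ℚ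
term n zero    = 0ℚ
term n (suc j) with suc j ≤? n
... | yes p = sgn (suc j) * H (n ∸ suc j) * ((+ 1) / (suc j ℕ.* (n C suc j)))
  {{m*n≢0 (suc j) (n C suc j) {{_}} {{nCk-nonZero n (suc j) p}}}}
... | no _ = 0ℚ

-- Put β n k = 1 / (k · C(n, k)), the Beta value B(k, n − k + 1). The Beta recurrence
-- B(x, y) = B(x + 1, y) + B(x, y + 1) reads β n k = β (n + 1) k + β (n + 1) (k + 1); with
-- H_{n+1−k} = H_{n−k} + 1/(n + 1 − k) and β (n + 1) k / (n + 1 − k) = β n k / (n + 1) it writes the
-- k-th summand for n as the k-th minus the (k + 1)-st summand for n + 1, minus (−1)^k β n k / (n + 1).
-- Summing over k, the differences telescope to −H_n / (n + 1), and by the same recurrence the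
-- alternating sum of β n k telescopes to −(1 − (−1)^n) / (n + 1).
module Submission where

open import Defs
open import Data.Nat as ℕ using (ℕ; zero; suc; _^_; _∸_; _≤_; s≤s; NonZero)
import Data.Nat.Properties as ℕP
open import Data.Nat.Combinatorics using (_C_; nC1≡n; nCn≡1; nCk+nC[k+1]≡[n+1]C[k+1])
open import Data.Nat.Tactic.RingSolver using (solve-∀)
open import Data.Integer as ℤ using (+_)
import Data.Integer.Properties as ℤP
import Data.Rational.Properties as ℚP
import Data.Rational.Unnormalised as ℚᵘ
import Data.Rational.Unnormalised.Properties as ℚᵘP
open import Data.Rational.Solver using (module +-*-Solver)
open import Relation.Binary.PropositionalEquality using (_≡_; refl; sym; trans; cong; cong₂; module ≡-Reasoning)
open import Relation.Nullary using (yes; no; contradiction)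

module BinomialIdentities where
  open import Data.Nat using (_+_; _*_)
  open ≡-Reasoning

  [1+k]*[1+n]C[1+k]≡[1+n]*nCk : ∀ n k → suc k * (suc n C suc k) ≡ suc n * (n C k)
  [1+k]*[1+n]C[1+k]≡[1+n]*nCk n       zero    = trans (ℕP.+-identityʳ (suc n C 1)) (trans (nC1≡n (suc n)) (sym (ℕP.*-identityʳ (suc n))))
  [1+k]*[1+n]C[1+k]≡[1+n]*nCk zero    (suc k) = ℕP.*-zeroʳ (suc (suc k))
  [1+k]*[1+n]C[1+k]≡[1+n]*nCk (suc n) (suc k) = begin
    suc (suc k) * (suc (suc n) C suc (suc k))
      ≡⟨ cong (suc (suc k) *_) (nCk+nC[k+1]≡[n+1]C[k+1] (suc n) (suc k)) ⟨
    suc (suc k) * (suc n C suc k + suc n C suc (suc k))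
      ≡⟨ regroup (suc k) (suc n C suc k) (suc n C suc (suc k)) ⟩
    suc n C suc k + (suc k * (suc n C suc k) + suc (suc k) * (suc n C suc (suc k)))
      ≡⟨ cong (λ x → suc n C suc k + x) (cong₂ _+_ ([1+k]*[1+n]C[1+k]≡[1+n]*nCk n k) ([1+k]*[1+n]C[1+k]≡[1+n]*nCk n (suc k))) ⟩
    suc n C suc k + (suc n * (n C k) + suc n * (n C suc k))
      ≡⟨ cong (λ x → suc n C suc k + x) (ℕP.*-distribˡ-+ (suc n) (n C k) (n C suc k)) ⟨
    suc n C suc k + suc n * (n C k + n C suc k)
      ≡⟨ cong (λ x → suc n C suc k + suc n * x) (nCk+nC[k+1]≡[n+1]C[k+1] n k) ⟩
    suc (suc n) * (suc n C suc k)
      ∎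
    where
    regroup : ∀ k x y → suc k * (x + y) ≡ x + (k * x + suc k * y)
    regroup = solve-∀

  [1+n]*nCk+k*[1+n]Ck≡[1+n]*[1+n]Ck : ∀ n k → suc n * (n C k) + k * (suc n C k) ≡ suc n * (suc n C k)
  [1+n]*nCk+k*[1+n]Ck≡[1+n]*[1+n]Ck n zero    = ℕP.+-identityʳ (suc n * 1)
  [1+n]*nCk+k*[1+n]Ck≡[1+n]*[1+n]Ck n (suc k) = begin
    suc n * (n C suc k) + suc k * (suc n C suc k) ≡⟨ cong (λ x → suc n * (n C suc k) + x) ([1+k]*[1+n]C[1+k]≡[1+n]*nCk n k) ⟩
    suc n * (n C suc k) + suc n * (n C k)         ≡⟨ ℕP.*-distribˡ-+ (suc n) (n C suc k) (n C k) ⟨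
    suc n * (n C suc k + n C k)                   ≡⟨ cong (suc n *_) (ℕP.+-comm (n C suc k) (n C k)) ⟩
    suc n * (n C k + n C suc k)                   ≡⟨ cong (suc n *_) (nCk+nC[k+1]≡[n+1]C[k+1] n k) ⟩
    suc n * (suc n C suc k)                       ∎

  [1+n]*nCk≡[1+n∸k]*[1+n]Ck : ∀ n k → k ≤ suc n → suc n * (n C k) ≡ (suc n ∸ k) * (suc n C k)
  [1+n]*nCk≡[1+n∸k]*[1+n]Ck n k k≤1+n = ℕP.+-cancelʳ-≡ (k * (suc n C k)) _ _ (begin
    suc n * (n C k) + k * (suc n C k)           ≡⟨ [1+n]*nCk+k*[1+n]Ck≡[1+n]*[1+n]Ck n k ⟩
    suc n * (suc n C k)                         ≡⟨ cong (_* (suc n C k)) (ℕP.m∸n+n≡m k≤1+n) ⟨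
    (suc n ∸ k + k) * (suc n C k)               ≡⟨ ℕP.*-distribʳ-+ (suc n C k) (suc n ∸ k) k ⟩
    (suc n ∸ k) * (suc n C k) + k * (suc n C k) ∎)

open BinomialIdentities
open import Data.Rational using (ℚ; _/_; _+_; _-_; _*_; -_; 0ℚ; 1ℚ; fromℚᵘ)

fromℚᵘ-homo-+ : ∀ p q → fromℚᵘ (p ℚᵘ.+ q) ≡ fromℚᵘ p + fromℚᵘ q
fromℚᵘ-homo-+ p q = ℚP.toℚᵘ-injective (ℚᵘP.≃-trans (ℚP.toℚᵘ-fromℚᵘ (p ℚᵘ.+ q))
  (ℚᵘP.≃-sym (ℚᵘP.≃-trans (ℚP.toℚᵘ-homo-+ (fromℚᵘ p) (fromℚᵘ q))
    (ℚᵘP.+-cong (ℚP.toℚᵘ-fromℚᵘ p) (ℚP.toℚᵘ-fromℚᵘ q)))))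

fromℚᵘ-homo-* : ∀ p q → fromℚᵘ (p ℚᵘ.* q) ≡ fromℚᵘ p * fromℚᵘ q
fromℚᵘ-homo-* p q = ℚP.toℚᵘ-injective (ℚᵘP.≃-trans (ℚP.toℚᵘ-fromℚᵘ (p ℚᵘ.* q))
  (ℚᵘP.≃-sym (ℚᵘP.≃-trans (ℚP.toℚᵘ-homo-* (fromℚᵘ p) (fromℚᵘ q))
    (ℚᵘP.*-cong (ℚP.toℚᵘ-fromℚᵘ p) (ℚP.toℚᵘ-fromℚᵘ q)))))

toℚ : ℕ → ℚ
toℚ n = + n / 1

-- Total reciprocal on ℕ with the junk value recip 0 = 0, which makes recip-* hold unconditionally.
recip : ℕ → ℚ
recip zero    = 0ℚ
recip (suc n) = + 1 / suc n

recip-/ : ∀ n .{{_ : NonZero n}} → recip n ≡ + 1 / n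
recip-/ (suc n) = refl

recip-* : ∀ m n → recip (m ℕ.* n) ≡ recip m * recip n
recip-* zero    n       = sym (ℚP.*-zeroˡ (recip n))
recip-* (suc m) zero    = trans (cong recip (ℕP.*-zeroʳ m)) (sym (ℚP.*-zeroʳ (recip (suc m))))
recip-* (suc m) (suc n) = fromℚᵘ-homo-* (ℚᵘ.mkℚᵘ (+ 1) m) (ℚᵘ.mkℚᵘ (+ 1) n)

toℚ-+ : ∀ m n → toℚ (m ℕ.+ n) ≡ toℚ m + toℚ n
toℚ-+ m n = trans (ℚP.fromℚᵘ-cong {p} {q} (ℚᵘ.*≡* (cong (ℤ._* + 1) ↥p≡↥q)))
                  (fromℚᵘ-homo-+ (ℚᵘ.mkℚᵘ (+ m) 0) (ℚᵘ.mkℚᵘ (+ n) 0))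
  where
  p = ℚᵘ.mkℚᵘ (+ (m ℕ.+ n)) 0
  q = ℚᵘ.mkℚᵘ (+ m) 0 ℚᵘ.+ ℚᵘ.mkℚᵘ (+ n) 0
  ↥p≡↥q : + (m ℕ.+ n) ≡ + m ℤ.* + 1 ℤ.+ + n ℤ.* + 1
  ↥p≡↥q = trans (ℤP.pos-+ m n) (sym (cong₂ ℤ._+_ (ℤP.*-identityʳ (+ m)) (ℤP.*-identityʳ (+ n))))

toℚ*recip≡1 : ∀ n .{{_ : NonZero n}} → toℚ n * recip n ≡ 1ℚ
toℚ*recip≡1 (suc n) = trans (sym (fromℚᵘ-homo-* p (ℚᵘ.1/ p))) (ℚP.fromℚᵘ-cong (ℚᵘP.*-inverseʳ p))
  where p = ℚᵘ.mkℚᵘ (+ suc n) 0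

recip≡toℚ*recip[*] : ∀ m n .{{_ : NonZero n}} → recip m ≡ toℚ n * recip (m ℕ.* n)
recip≡toℚ*recip[*] m n = begin
  recip m                      ≡⟨ ℚP.*-identityʳ (recip m) ⟨
  recip m * 1ℚ                 ≡⟨ cong (recip m *_) (toℚ*recip≡1 n) ⟨
  recip m * (toℚ n * recip n)  ≡⟨ solve 3 (λ a b c → a :* (b :* c) := b :* (a :* c)) refl (recip m) (toℚ n) (recip n) ⟩
  toℚ n * (recip m * recip n)  ≡⟨ cong (toℚ n *_) (recip-* m n) ⟨
  toℚ n * recip (m ℕ.* n)      ∎
  where open ≡-Reasoning
        open +-*-Solver

recip-+ : ∀ a b c .{{_ : NonZero b}} .{{_ : NonZero c}} →
          a ℕ.* (b ℕ.+ c) ≡ b ℕ.* c → recip a ≡ recip b + recip c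
recip-+ a b@(suc _) c eq = sym (begin
  recip b + recip c                                  ≡⟨ cong₂ _+_ (recip≡toℚ*recip[*] b c) (recip≡toℚ*recip[*] c b) ⟩
  toℚ c * recip (b ℕ.* c) + toℚ b * recip (c ℕ.* b)  ≡⟨ cong (λ x → toℚ c * recip (b ℕ.* c) + toℚ b * recip x) (ℕP.*-comm c b) ⟩
  toℚ c * recip (b ℕ.* c) + toℚ b * recip (b ℕ.* c)  ≡⟨ ℚP.*-distribʳ-+ (recip (b ℕ.* c)) (toℚ c) (toℚ b) ⟨
  (toℚ c + toℚ b) * recip (b ℕ.* c)                  ≡⟨ cong₂ _*_ (trans (toℚ-+ b c) (ℚP.+-comm (toℚ b) (toℚ c))) (cong recip eq) ⟨
  toℚ (b ℕ.+ c) * recip (a ℕ.* (b ℕ.+ c))            ≡⟨ recip≡toℚ*recip[*] a (b ℕ.+ c) ⟨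
  recip a                                            ∎)
  where open ≡-Reasoning

Σ₁-cong : ∀ n {f g : ℕ → ℚ} → (∀ k .{{_ : NonZero k}} → k ≤ n → f k ≡ g k) → Σ₁ n f ≡ Σ₁ n g
Σ₁-cong zero    f≗g = refl
Σ₁-cong (suc n) f≗g = cong₂ _+_ (Σ₁-cong n (λ k k≤n → f≗g k (ℕP.m≤n⇒m≤1+n k≤n))) (f≗g (suc n) ℕP.≤-refl)

Σ₁-telescope : ∀ n (f : ℕ → ℚ) → Σ₁ n (λ k → f k - f (suc k)) ≡ f 1 - f (suc n)
Σ₁-telescope zero    f = sym (ℚP.+-inverseʳ (f 1))
Σ₁-telescope (suc n) f = trans (cong (_+ (f (suc n) - f (suc (suc n)))) (Σ₁-telescope n f))
  (solve 3 (λ a b c → (a :- b) :+ (b :- c) := a :- c) refl (f 1) (f (suc n)) (f (suc (suc n))))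
  where open +-*-Solver

Σ₁-- : ∀ n (f g : ℕ → ℚ) → Σ₁ n (λ k → f k - g k) ≡ Σ₁ n f - Σ₁ n g
Σ₁-- zero    f g = refl
Σ₁-- (suc n) f g = trans (cong (_+ (f (suc n) - g (suc n))) (Σ₁-- n f g))
  (solve 4 (λ a b c d → (a :- b) :+ (c :- d) := (a :+ c) :- (b :+ d)) refl (Σ₁ n f) (Σ₁ n g) (f (suc n)) (g (suc n)))
  where open +-*-Solver

Σ₁-*ˡ : ∀ n c (f : ℕ → ℚ) → Σ₁ n (λ k → c * f k) ≡ c * Σ₁ n f
Σ₁-*ˡ zero    c f = sym (ℚP.*-zeroʳ c)
Σ₁-*ˡ (suc n) c f = trans (cong (_+ (c * f (suc n))) (Σ₁-*ˡ n c f)) (sym (ℚP.*-distribˡ-+ c (Σ₁ n f) (f (suc n))))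

β : ℕ → ℕ → ℚ
β n k = recip (k ℕ.* (n C k))

β-1 : ∀ n → β n 1 ≡ recip n
β-1 n = cong recip (trans (ℕP.+-identityʳ (n C 1)) (nC1≡n n))

β-diag : ∀ n → β n n ≡ recip n
β-diag n = cong recip (trans (cong (n ℕ.*_) (nCn≡1 n)) (ℕP.*-identityʳ n))

k*nCk≢0 : ∀ n k .{{_ : NonZero k}} → k ≤ n → NonZero (k ℕ.* (n C k))
k*nCk≢0 n k {{k≢0}} k≤n = ℕP.m*n≢0 k (n C k) {{k≢0}} {{nCk-nonZero n k k≤n}}

term≡sgn*H*β : ∀ n k .{{_ : NonZero k}} → k ≤ n → term n k ≡ sgn k * H (n ∸ k) * β n k
term≡sgn*H*β n (suc j) k≤n with suc j ℕP.≤? n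
... | yes _   = cong (sgn (suc j) * H (n ∸ suc j) *_) (sym (recip-/ _ {{k*nCk≢0 n (suc j) k≤n}}))
... | no k≰n = contradiction k≤n k≰n

β-recurrence : ∀ n k .{{_ : NonZero k}} → k ≤ n → β n k ≡ β (suc n) k + β (suc n) (suc k)
β-recurrence n k k≤n =
  recip-+ a b c {{k*nCk≢0 (suc n) k (ℕP.m≤n⇒m≤1+n k≤n)}} {{k*nCk≢0 (suc n) (suc k) (s≤s k≤n)}} (begin
  a ℕ.* (b ℕ.+ c)                          ≡⟨ cong (λ x → a ℕ.* (b ℕ.+ x)) ([1+k]*[1+n]C[1+k]≡[1+n]*nCk n k) ⟩
  a ℕ.* (b ℕ.+ suc n ℕ.* (n C k))          ≡⟨ cong (a ℕ.*_) (ℕP.+-comm b (suc n ℕ.* (n C k))) ⟩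
  a ℕ.* (suc n ℕ.* (n C k) ℕ.+ b)          ≡⟨ cong (a ℕ.*_) ([1+n]*nCk+k*[1+n]Ck≡[1+n]*[1+n]Ck n k) ⟩
  a ℕ.* (suc n ℕ.* (suc n C k))            ≡⟨ exchange k (n C k) (suc n) (suc n C k) ⟩
  b ℕ.* (suc n ℕ.* (n C k))                ≡⟨ cong (b ℕ.*_) ([1+k]*[1+n]C[1+k]≡[1+n]*nCk n k) ⟨
  b ℕ.* c                                  ∎)
  where
  open ≡-Reasoning
  a = k ℕ.* (n C k)
  b = k ℕ.* (suc n C k)
  c = suc k ℕ.* (suc n C suc k)
  exchange : ∀ k x m y → (k ℕ.* x) ℕ.* (m ℕ.* y) ≡ (k ℕ.* y) ℕ.* (m ℕ.* x)
  exchange = solve-∀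

β-shift : ∀ n k → k ≤ suc n → β (suc n) k * recip (suc n ∸ k) ≡ β n k * recip (suc n)
β-shift n k k≤1+n = begin
  β (suc n) k * recip (suc n ∸ k)                 ≡⟨ recip-* (k ℕ.* (suc n C k)) (suc n ∸ k) ⟨
  recip (k ℕ.* (suc n C k) ℕ.* (suc n ∸ k))       ≡⟨ cong recip (shuffle k (suc n C k) (suc n ∸ k)) ⟩
  recip (k ℕ.* ((suc n ∸ k) ℕ.* (suc n C k)))     ≡⟨ cong (λ x → recip (k ℕ.* x)) ([1+n]*nCk≡[1+n∸k]*[1+n]Ck n k k≤1+n) ⟨
  recip (k ℕ.* (suc n ℕ.* (n C k)))               ≡⟨ cong recip (shuffle k (n C k) (suc n)) ⟨
  recip (k ℕ.* (n C k) ℕ.* suc n)                 ≡⟨ recip-* (k ℕ.* (n C k)) (suc n) ⟩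
  β n k * recip (suc n)                           ∎
  where
  open ≡-Reasoning
  shuffle : ∀ k x y → k ℕ.* x ℕ.* y ≡ k ℕ.* (y ℕ.* x)
  shuffle = solve-∀

H[1+n∸k] : ∀ n k → k ≤ n → H (suc n ∸ k) ≡ H (n ∸ k) + recip (suc n ∸ k)
H[1+n∸k] n k k≤n rewrite ℕP.+-∸-assoc 1 k≤n = refl

term-step : ∀ n k .{{_ : NonZero k}} → k ≤ n →
            term n k ≡ (term (suc n) k - term (suc n) (suc k)) - recip (suc n) * (sgn k * β n k)
term-step n k k≤n = begin
  term n k
    ≡⟨ term≡sgn*H*β n k k≤n ⟩
  s * h * β n k
    ≡⟨ cong (s * h *_) (β-recurrence n k k≤n) ⟩
  s * h * (b + b′)
    ≡⟨ expand s h r b b′ ⟩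
  (s * (h + r) * b - (- s) * h * b′) - s * (b * r)
    ≡⟨ cong₂ (λ x y → (x - y) - s * (b * r)) term[1+n]k term[1+n][1+k] ⟨
  (term (suc n) k - term (suc n) (suc k)) - s * (b * r)
    ≡⟨ cong (λ x → (term (suc n) k - term (suc n) (suc k)) - s * x) (β-shift n k (ℕP.m≤n⇒m≤1+n k≤n)) ⟩
  (term (suc n) k - term (suc n) (suc k)) - s * (β n k * recip (suc n))
    ≡⟨ cong (λ x → (term (suc n) k - term (suc n) (suc k)) - x) (regroup s (β n k) (recip (suc n))) ⟩
  (term (suc n) k - term (suc n) (suc k)) - recip (suc n) * (s * β n k)
    ∎
  where
  open ≡-Reasoning
  open +-*-Solver
  s = sgn k
  h = H (n ∸ k)
  r = recip (suc n ∸ k)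
  b = β (suc n) k
  b′ = β (suc n) (suc k)
  term[1+n]k : term (suc n) k ≡ s * (h + r) * b
  term[1+n]k = trans (term≡sgn*H*β (suc n) k (ℕP.m≤n⇒m≤1+n k≤n)) (cong (λ x → s * x * b) (H[1+n∸k] n k k≤n))
  term[1+n][1+k] : term (suc n) (suc k) ≡ (- s) * h * b′
  term[1+n][1+k] = term≡sgn*H*β (suc n) (suc k) (s≤s k≤n)
  expand : ∀ s h r b b′ → s * h * (b + b′) ≡ (s * (h + r) * b - (- s) * h * b′) - s * (b * r)
  expand = solve 5 (λ s h r b b′ → s :* h :* (b :+ b′) := (s :* (h :+ r) :* b :- (:- s) :* h :* b′) :- s :* (b :* r)) refl
  regroup : ∀ s x y → s * (x * y) ≡ y * (s * x)
  regroup = solve 3 (λ s x y → s :* (x :* y) := y :* (s :* x)) refl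

signed-β-step : ∀ n k .{{_ : NonZero k}} → k ≤ n → sgn k * β n k ≡ sgn k * β (suc n) k - sgn (suc k) * β (suc n) (suc k)
signed-β-step n k k≤n = trans (cong (sgn k *_) (β-recurrence n k k≤n))
  (solve 3 (λ s b b′ → s :* (b :+ b′) := s :* b :- (:- s) :* b′) refl (sgn k) (β (suc n) k) (β (suc n) (suc k)))
  where open +-*-Solver

alternating-β-sum : ∀ n → Σ₁ n (λ k → sgn k * β n k) ≡ (sgn n - 1ℚ) * recip (suc n)
alternating-β-sum n = begin
  Σ₁ n (λ k → sgn k * β n k)                              ≡⟨ Σ₁-cong n (signed-β-step n) ⟩
  Σ₁ n (λ k → sgn k * β (suc n) k - sgn (suc k) * β (suc n) (suc k))
                                                          ≡⟨ Σ₁-telescope n (λ k → sgn k * β (suc n) k) ⟩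
  (- 1ℚ) * β (suc n) 1 - (- sgn n) * β (suc n) (suc n)   ≡⟨ cong₂ (λ x y → (- 1ℚ) * x - (- sgn n) * y) (β-1 (suc n)) (β-diag (suc n)) ⟩
  (- 1ℚ) * r - (- sgn n) * r                              ≡⟨ solve 2 (λ s r → (:- con 1ℚ) :* r :- (:- s) :* r := (s :- con 1ℚ) :* r) refl (sgn n) r ⟩
  (sgn n - 1ℚ) * r                                        ∎
  where
  open ≡-Reasoning
  open +-*-Solver
  r = recip (suc n)

term-1 : ∀ n → term (suc n) 1 ≡ (- 1ℚ) * H n * recip (suc n)
term-1 n = trans (term≡sgn*H*β (suc n) 1 (s≤s ℕ.z≤n)) (cong ((- 1ℚ) * H n *_) (β-1 (suc n)))

term-diag : ∀ n .{{_ : NonZero n}} → term n n ≡ 0ℚ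
term-diag n = begin
  term n n                  ≡⟨ term≡sgn*H*β n n ℕP.≤-refl ⟩
  sgn n * H (n ∸ n) * β n n ≡⟨ cong (λ x → sgn n * H x * β n n) (ℕP.n∸n≡0 n) ⟩
  sgn n * 0ℚ * β n n        ≡⟨ cong (_* β n n) (ℚP.*-zeroʳ (sgn n)) ⟩
  0ℚ * β n n                ≡⟨ ℚP.*-zeroˡ (β n n) ⟩
  0ℚ                        ∎
  where open ≡-Reasoning

Σ₁-term : ∀ n → Σ₁ n (term n) ≡ (term (suc n) 1 - term (suc n) (suc n)) - recip (suc n) * Σ₁ n (λ k → sgn k * β n k)
Σ₁-term n = begin
  Σ₁ n (term n)                                        ≡⟨ Σ₁-cong n (term-step n) ⟩
  Σ₁ n (λ k → (t k - t (suc k)) - r * w k)             ≡⟨ Σ₁-- n (λ k → t k - t (suc k)) (λ k → r * w k) ⟩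
  Σ₁ n (λ k → t k - t (suc k)) - Σ₁ n (λ k → r * w k)  ≡⟨ cong₂ _-_ (Σ₁-telescope n t) (Σ₁-*ˡ n r w) ⟩
  (t 1 - t (suc n)) - r * Σ₁ n w                       ∎
  where
  open ≡-Reasoning
  t = term (suc n)
  r = recip (suc n)
  w : ℕ → ℚ
  w k = sgn k * β n k

mainTheorem19 : (n : ℕ) →
    Σ₁ n (term n) ≡ (1ℚ - sgn n) * ((+ 1) / (suc n ^ 2)) - H n * ((+ 1) / suc n)
mainTheorem19 n = begin
  Σ₁ n (term n)
    ≡⟨ Σ₁-term n ⟩
  (term (suc n) 1 - term (suc n) (suc n)) - r * Σ₁ n (λ k → sgn k * β n k)
    ≡⟨ cong₂ (λ x y → (x - y) - r * Σ₁ n (λ k → sgn k * β n k)) (term-1 n) (term-diag (suc n)) ⟩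
  ((- 1ℚ) * H n * r - 0ℚ) - r * Σ₁ n (λ k → sgn k * β n k)
    ≡⟨ cong (λ x → ((- 1ℚ) * H n * r - 0ℚ) - r * x) (alternating-β-sum n) ⟩
  ((- 1ℚ) * H n * r - 0ℚ) - r * ((sgn n - 1ℚ) * r)
    ≡⟨ solve 3 (λ h r s → ((:- con 1ℚ) :* h :* r :- con 0ℚ) :- r :* ((s :- con 1ℚ) :* r)
                       := (con 1ℚ :- s) :* (r :* r) :- h :* r) refl (H n) r (sgn n) ⟩
  (1ℚ - sgn n) * (r * r) - H n * r
    ≡⟨ cong (λ x → (1ℚ - sgn n) * x - H n * r) r*r ⟩
  (1ℚ - sgn n) * ((+ 1) / (suc n ^ 2)) - H n * r
    ∎
  where
  open ≡-Reasoning
  open +-*-Solver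
  r = recip (suc n)
  r*r : r * r ≡ (+ 1) / (suc n ^ 2)
  r*r = trans (sym (recip-* (suc n) (suc n))) (cong recip (cong (suc n ℕ.*_) (sym (ℕP.*-identityʳ (suc n)))))
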